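{- Let $S$ be a $T$--signature. Then the category $\mathrm{Rep}(S)$ of representations of $S$ has an initial object $\Sigma(S)$.
   Context: Fix a set $T$ of object types and let $[T,\mathrm{Set}]$ be the category of $T$-indexed families of sets, with morphisms $f:V\to W$ the families of maps $f_t:V_t\to W_t$. A monad $P$ on a category $\mathcal{C}$ is given (as a Kleisli triple) by an object map $P$, morphisms $\eta_c : c\to Pc$ and a substitution $\sigma : \mathcal{C}(c,Pd)\to\mathcal{C}(Pc,Pd)$ satisfying the usual three laws; a morphism of monads $\tau:P\to Q$ is a family $\tau_c : Pc\to Qc$ commuting with $\eta$ and with substitution. A module $M$ over $P$ with codomain $\mathcal{D}$ is an object map $M:\mathcal{C}\to\mathcal{D}$ with a substitution $\varsigma:\mathcal{C}(c,Pd)\to\mathcal{D}(Mc,Md)$ compatible with $\eta$ and $\sigma$; module morphisms are families commuting with module substitution. Every monad $P$ is a module over itself; for a $Q$-module $M$ and monad morphism $h:P\to Q$, the pullback $h^*M$ is the $P$-module with the same object map and substitution $f\mapsto \varsigma^M(f;h_d)$, and $h$ induces a $P$-module morphism $P\to h^*Q$. For a $P$-module $M$ with codomain $[T,\mathrm{Set}]$ and $u\in T$, the fibre $M_u$ is the $P$-module with codomain $\mathrm{Set}$ given by $V\mapsto (MV)(u)$, and the derived module $M^u$ is $V\mapsto M(V+D(u))$ where $D(u)$ contains one fresh variable of type $u$ (iterating along a list $\vec{s}$ of types gives $M^{\vec{s}}$); products of modules are taken componentwise. A $T$--arity is $\alpha = (\vec{s}_1)t_1,\ldots,(\vec{s}_n)t_n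 \to t_0$ with $t_i\in T$ and $\vec{s}_i$ lists of elements of $T$ (the variables bound in the $i$-th argument); a $T$--signature is a family of $T$--arities. A representation of $\alpha$ in a monad $R$ on $[T,\mathrm{Set}]$ is an $R$-module morphism $(R^{\vec{s}_1})_{t_1}\times\cdots\times(R^{\vec{s}_n})_{t_n}\to R_{t_0}$. A representation of a signature $S$ is a monad $P$ on $[T,\mathrm{Set}]$ together with a representation of each arity of $S$ in $P$. A morphism of representations $P\to Q$ of $S$ is a monad morphism $f:P\to Q$ such that for every arity $\alpha$ of $S$ the square of $P$-modules commutes: $\alpha^P ; f_{t_0} = \prod_i (f^{\vec{s}_i})_{t_i} ; f^*(\alpha^Q)$ (up to the canonical isomorphisms expressing that pullback commutes with products, derivation and fibres). These form the category $\mathrm{Rep}(S)$. An initial object is an object with exactly one morphism to every object. -}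

module Defs where

open import Data.List using (List; []; _∷_; map)
open import Data.Product using (_×_; _,_; Σ; Σ-syntax)
open import Data.Sum using (_⊎_; inj₁; inj₂)
open import Data.Unit using (⊤; tt)
open import Relation.Binary.PropositionalEquality using (_≡_)

module _ (T : Set) where

  Fam : Set₁
  Fam = T → Set

  _⇒_ : Fam → Fam → Set
  V ⇒ W = (t : T) → V t → W t

  _≐_ : {V W : Fam} → V ⇒ W → V ⇒ W → Set
  f ≐ g = ∀ t x → f t x ≡ g t x

  idF : {V : Fam} → V ⇒ V
  idF t x = x

  _∘F_ : {U V W : Fam} → V ⇒ W → U ⇒ V → U ⇒ W
  (g ∘F f) t x = g t (f t x)

  _⊕_ : Fam → Fam → Fam
  (V ⊕ W) t = V t ⊎ W t

  -- D(u): exactly one (fresh) variable, of type u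
  data Fresh (u : T) : T → Set where
    fresh : Fresh u u

  D : T → Fam
  D u = Fresh u

  -- Monads on [T, Set] as Kleisli triples

  record Monad : Set₁ where
    field
      P      : Fam → Fam
      η      : ∀ {V} → V ⇒ P V
      σ      : ∀ {V W} → V ⇒ P W → P V ⇒ P W
      σ-cong : ∀ {V W} {f g : V ⇒ P W} → f ≐ g → σ f ≐ σ g
      σ-η    : ∀ {V W} (f : V ⇒ P W) → (σ f ∘F η) ≐ f
      η-σ    : ∀ {V} → σ (η {V}) ≐ idF
      σ-σ    : ∀ {U V W} (f : U ⇒ P V) (g : V ⇒ P W) →
               (σ g ∘F σ f) ≐ σ (σ g ∘F f)

    pmap : ∀ {V W} → V ⇒ W → P V ⇒ P W
    pmap g = σ (η ∘F g)

  open Monad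

  record MonadMor (P Q : Monad) : Set₁ where
    field
      τ   : ∀ V → P .Monad.P V ⇒ Q .Monad.P V
      τ-η : ∀ V → (τ V ∘F P .η) ≐ Q .η
      τ-σ : ∀ {V W} (f : V ⇒ P .Monad.P W) →
            (τ W ∘F P .σ f) ≐ (Q .σ (τ W ∘F f) ∘F τ V)

  record Module (R : Monad) : Set₁ where
    field
      M : Fam → Fam
      ς : ∀ {V W} → V ⇒ R .Monad.P W → M V ⇒ M W

  record Module₀ (R : Monad) : Set₁ where
    field
      M : Fam → Set
      ς : ∀ {V W} → V ⇒ R .Monad.P W → M V → M W

  record ModMor₀ {R : Monad} (M N : Module₀ R) : Set₁ where
    field
      φ   : ∀ V → Module₀.M M V → Module₀.M N V
      φ-ς : ∀ {V W} (f : V ⇒ R .Monad.P W) (x : Module₀.M M V) →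
            φ W (Module₀.ς M f x) ≡ Module₀.ς N f (φ V x)

  taut : (R : Monad) → Module R
  taut R = record { M = R .Monad.P ; ς = R .σ }

  lift : (R : Monad) {V W : Fam} (u : T) →
         V ⇒ R .Monad.P W → (V ⊕ D u) ⇒ R .Monad.P (W ⊕ D u)
  lift R u f t (inj₁ x) = pmap R (λ _ → inj₁) t (f t x)
  lift R u f t (inj₂ y) = R .η t (inj₂ y)

  derived : {R : Monad} → Module R → T → Module R
  derived {R} M u = record
    { M = λ V → Module.M M (V ⊕ D u)
    ; ς = λ f → Module.ς M (lift R u f) }

  derivedL : {R : Monad} → Module R → List T → Module R
  derivedL M []       = M
  derivedL M (s ∷ ss) = derivedL (derived M s) ss

  fibre : {R : Monad} → Module R → T → Module₀ R
  fibre M u = record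
    { M = λ V → Module.M M V u
    ; ς = λ f x → Module.ς M f u x }

  prodM : {R : Monad} → List (Module₀ R) → Module₀ R
  prodM []       = record { M = λ _ → ⊤ ; ς = λ _ _ → tt }
  prodM (N ∷ Ns) = record
    { M = λ V → Module₀.M N V × Module₀.M (prodM Ns) V
    ; ς = λ f → λ { (x , xs) → Module₀.ς N f x , Module₀.ς (prodM Ns) f xs } }

  -- (s⃗₁)t₁, …, (s⃗ₙ)tₙ → t₀
  record Arity : Set where
    constructor _⟶_
    field
      args : List (List T × T)
      res  : T

  record Signature : Set₁ where
    field
      Idx   : Set
      arity : Idx → Arity

  argModule : (R : Monad) → List T × T → Module₀ R
  argModule R (ss , t) = fibre (derivedL (taut R) ss) t

  domModule : (R : Monad) → Arity → Module₀ R
  domModule R α = prodM (map (argModule R) (Arity.args α))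

  codModule : (R : Monad) → Arity → Module₀ R
  codModule R α = fibre (taut R) (Arity.res α)

  Representation : Arity → Monad → Set₁
  Representation α R = ModMor₀ (domModule R α) (codModule R α)

  record RepObj (S : Signature) : Set₁ where
    field
      monad : Monad
      rep   : (i : Signature.Idx S) →
              Representation (Signature.arity S i) monad

  -- components of the induced morphism on derived modules
  -- (object maps of f^*(M) and M coincide)
  derivedComp : {P Q : Monad} (M : Module P) (N : Module Q) →
                (∀ V → Module.M M V ⇒ Module.M N V) →
                (ss : List T) →
                ∀ V → Module.M (derivedL M ss) V ⇒ Module.M (derivedL N ss) V
  derivedComp M N φ []       = φ
  derivedComp M N φ (s ∷ ss) =
    derivedComp (derived M s) (derived N s) (λ V → φ (V ⊕ D s)) ss

  argsComp : {P Q : Monad} → MonadMor P Q →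
             (as : List (List T × T)) → ∀ V →
             Module₀.M (prodM (map (argModule P) as)) V →
             Module₀.M (prodM (map (argModule Q) as)) V
  argsComp f []              V tt       = tt
  argsComp {P} {Q} f ((ss , t) ∷ as) V (x , xs) =
    derivedComp (taut P) (taut Q) (MonadMor.τ f) ss V t x , argsComp f as V xs

  record RepMor {S : Signature} (A B : RepObj S) : Set₁ where
    field
      mor : MonadMor (RepObj.monad A) (RepObj.monad B)
      commutes :
        ∀ (i : Signature.Idx S) V
          (x : Module₀.M (domModule (RepObj.monad A) (Signature.arity S i)) V) →
        MonadMor.τ mor V (Arity.res (Signature.arity S i))
          (ModMor₀.φ (RepObj.rep A i) V x)
        ≡ ModMor₀.φ (RepObj.rep B i) V
            (argsComp mor (Arity.args (Signature.arity S i)) V x)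

  _≈R_ : {S : Signature} {A B : RepObj S} → RepMor A B → RepMor A B → Set₁
  f ≈R g = ∀ V t x →
    MonadMor.τ (RepMor.mor f) V t x ≡ MonadMor.τ (RepMor.mor g) V t x

  IsInitial : (S : Signature) → RepObj S → Set₁
  IsInitial S I =
    ((R : RepObj S) → RepMor I R) ×
    ((R : RepObj S) (f g : RepMor I R) → f ≈R g)

  HasInitial : Signature → Set₁
  HasInitial S = Σ[ I ∈ RepObj S ] IsInitial S I

module Submission where

-- Σ(S) V t is the set of well-typed terms of type t over the T-indexed family
-- of variables V, with one constructor for each arity of S whose k-th argument
-- is a term in V extended by the variables s⃗ₖ bound there.
--    Fold commutes with renaming, hence with substitution, so it is a morphism
--    of representations; any other morphism agrees with it by induction on
--    terms, using only its compatibility with η and with the arities.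

open import Defs
open import Data.List using (List; []; _∷_; map)
open import Data.Product using (_×_; _,_)
open import Data.Sum using (inj₁; inj₂)
open import Data.Unit using (tt)
open import Relation.Binary.PropositionalEquality
  using (_≡_; refl; sym; trans; cong; cong₂; module ≡-Reasoning)

module DerivedModules (T : Set) where

  Ctx : Set₁
  Ctx = Fam T

  _⇛_ : Ctx → Ctx → Set
  _⇛_ = _⇒_ T

  _≗_ : {V W : Ctx} → V ⇛ W → V ⇛ W → Set
  _≗_ = _≐_ T

  _⊚_ : {U V W : Ctx} → V ⇛ W → U ⇛ V → U ⇛ W
  _⊚_ = _∘F_ T

  _▷_ : Ctx → T → Ctx
  V ▷ s = _⊕_ T V (D T s)

  -- V ▷▷ s⃗ is the context at which M^{s⃗} evaluates M (head of s⃗ outermost).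
  _▷▷_ : Ctx → List T → Ctx
  V ▷▷ []       = V
  V ▷▷ (s ∷ ss) = (V ▷▷ ss) ▷ s

  liftMany : (R : Monad T) {V W : Ctx} (ss : List T) →
             V ⇛ Monad.P R W → (V ▷▷ ss) ⇛ Monad.P R (W ▷▷ ss)
  liftMany R []       f = f
  liftMany R (s ∷ ss) f = lift T R s (liftMany R ss f)

  toExt : {R : Monad T} (M : Module T R) (ss : List T) →
          ∀ V t → Module.M (derivedL T M ss) V t → Module.M M (V ▷▷ ss) t
  toExt M []       V t x = x
  toExt M (s ∷ ss) V t x = toExt (derived T M s) ss V t x

  fromExt : {R : Monad T} (M : Module T R) (ss : List T) →
            ∀ V t → Module.M M (V ▷▷ ss) t → Module.M (derivedL T M ss) V t
  fromExt M []       V t x = x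
  fromExt M (s ∷ ss) V t x = fromExt (derived T M s) ss V t x

  toExt-fromExt : {R : Monad T} (M : Module T R) (ss : List T) →
                  ∀ V t x → toExt M ss V t (fromExt M ss V t x) ≡ x
  toExt-fromExt M []       V t x = refl
  toExt-fromExt M (s ∷ ss) V t x = toExt-fromExt (derived T M s) ss V t x

  fromExt-ς : {R : Monad T} (M : Module T R) (ss : List T) →
              ∀ {V W} (f : V ⇛ Monad.P R W) t x →
              Module.ς (derivedL T M ss) f t (fromExt M ss V t x)
              ≡ fromExt M ss W t (Module.ς M (liftMany R ss f) t x)
  fromExt-ς M []       f t x = refl
  fromExt-ς M (s ∷ ss) f t x = fromExt-ς (derived T M s) ss f t x

  toExt-ς : {R : Monad T} (M : Module T R) (ss : List T) →
            ∀ {V W} (f : V ⇛ Monad.P R W) t x →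
            toExt M ss W t (Module.ς (derivedL T M ss) f t x)
            ≡ Module.ς M (liftMany R ss f) t (toExt M ss V t x)
  toExt-ς M []       f t x = refl
  toExt-ς M (s ∷ ss) f t x = toExt-ς (derived T M s) ss f t x

  derivedComp-ext : {P Q : Monad T} (M : Module T P) (N : Module T Q)
                    (φ : ∀ V → Module.M M V ⇛ Module.M N V) (ss : List T) →
                    ∀ V t x →
                    derivedComp T M N φ ss V t x
                    ≡ fromExt N ss V t (φ (V ▷▷ ss) t (toExt M ss V t x))
  derivedComp-ext M N φ []       V t x = refl
  derivedComp-ext M N φ (s ∷ ss) V t x =
    derivedComp-ext (derived T M s) (derived T N s) (λ V → φ (V ▷ s)) ss V t x

  ArgTuple : (R : Monad T) → List (List T × T) → Ctx → Set
  ArgTuple R as V = Module₀.M (prodM T (map (argModule T R) as)) V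

  substArgs : (R : Monad T) (as : List (List T × T)) {V W : Ctx} →
              V ⇛ Monad.P R W → ArgTuple R as V → ArgTuple R as W
  substArgs R as = Module₀.ς (prodM T (map (argModule T R) as))

module Syntax (T : Set) (S : Signature T) where
  open DerivedModules T
  open Signature S

  data Tm (V : Ctx) : T → Set
  data Args (V : Ctx) : List (List T × T) → Set

  data Tm V where
    var : ∀ {t} → V t → Tm V t
    con : (i : Idx) → Args V (Arity.args (arity i)) → Tm V (Arity.res (arity i))

  data Args V where
    []  : Args V []
    _∷_ : ∀ {ss t as} → Tm (V ▷▷ ss) t → Args V as → Args V ((ss , t) ∷ as)

  varF : ∀ {V} → V ⇛ Tm V
  varF t x = var x

  renUnder : ∀ {V W} ss → V ⇛ W → (V ▷▷ ss) ⇛ (W ▷▷ ss)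
  renUnder []       ρ t x        = ρ t x
  renUnder (s ∷ ss) ρ t (inj₁ x) = inj₁ (renUnder ss ρ t x)
  renUnder (s ∷ ss) ρ t (inj₂ y) = inj₂ y

  ren : ∀ {V W} → V ⇛ W → Tm V ⇛ Tm W
  renA : ∀ {V W as} → V ⇛ W → Args V as → Args W as
  ren ρ t (var x)    = var (ρ t x)
  ren ρ _ (con i as) = con i (renA ρ as)
  renA ρ []                  = []
  renA ρ (_∷_ {ss} {t} x xs) = ren (renUnder ss ρ) t x ∷ renA ρ xs

  wk : ∀ {V} s → V ⇛ (V ▷ s)
  wk s _ = inj₁

  -- Substitution, lifted under binders by weakening (a renaming, so that the
  -- recursion below is structural).
  liftSub : ∀ {V W} s → V ⇛ Tm W → (V ▷ s) ⇛ Tm (W ▷ s)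
  liftSub s f t (inj₁ x) = ren (wk s) t (f t x)
  liftSub s f t (inj₂ y) = var (inj₂ y)

  liftSubs : ∀ {V W} ss → V ⇛ Tm W → (V ▷▷ ss) ⇛ Tm (W ▷▷ ss)
  liftSubs []       f = f
  liftSubs (s ∷ ss) f = liftSub s (liftSubs ss f)

  sub : ∀ {V W} → V ⇛ Tm W → Tm V ⇛ Tm W
  subA : ∀ {V W as} → V ⇛ Tm W → Args V as → Args W as
  sub f t (var x)    = f t x
  sub f _ (con i as) = con i (subA f as)
  subA f []                  = []
  subA f (_∷_ {ss} {t} x xs) = sub (liftSubs ss f) t x ∷ subA f xs

  renUnder-cong : ∀ {V W} ss {ρ ρ′ : V ⇛ W} → ρ ≗ ρ′ → renUnder ss ρ ≗ renUnder ss ρ′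
  renUnder-cong []       e t x        = e t x
  renUnder-cong (s ∷ ss) e t (inj₁ x) = cong inj₁ (renUnder-cong ss e t x)
  renUnder-cong (s ∷ ss) e t (inj₂ y) = refl

  ren-cong : ∀ {V W} {ρ ρ′ : V ⇛ W} → ρ ≗ ρ′ → ren ρ ≗ ren ρ′
  renA-cong : ∀ {V W as} {ρ ρ′ : V ⇛ W} → ρ ≗ ρ′ → (xs : Args V as) → renA ρ xs ≡ renA ρ′ xs
  ren-cong e t (var x)    = cong var (e t x)
  ren-cong e _ (con i as) = cong (con i) (renA-cong e as)
  renA-cong e []                  = refl
  renA-cong e (_∷_ {ss} {t} x xs) =
    cong₂ _∷_ (ren-cong (renUnder-cong ss e) t x) (renA-cong e xs)

  liftSubs-cong : ∀ {V W} ss {f g : V ⇛ Tm W} → f ≗ g → liftSubs ss f ≗ liftSubs ss g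
  liftSubs-cong []       e t x        = e t x
  liftSubs-cong (s ∷ ss) e t (inj₁ x) = cong (ren (wk s) t) (liftSubs-cong ss e t x)
  liftSubs-cong (s ∷ ss) e t (inj₂ y) = refl

  sub-cong : ∀ {V W} {f g : V ⇛ Tm W} → f ≗ g → sub f ≗ sub g
  subA-cong : ∀ {V W as} {f g : V ⇛ Tm W} → f ≗ g → (xs : Args V as) → subA f xs ≡ subA g xs
  sub-cong e t (var x)    = e t x
  sub-cong e _ (con i as) = cong (con i) (subA-cong e as)
  subA-cong e []                  = refl
  subA-cong e (_∷_ {ss} {t} x xs) =
    cong₂ _∷_ (sub-cong (liftSubs-cong ss e) t x) (subA-cong e xs)

  renUnder-⊚ : ∀ {U V W} ss (ρ : U ⇛ V) (ρ′ : V ⇛ W) →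
               (renUnder ss ρ′ ⊚ renUnder ss ρ) ≗ renUnder ss (ρ′ ⊚ ρ)
  renUnder-⊚ []       ρ ρ′ t x        = refl
  renUnder-⊚ (s ∷ ss) ρ ρ′ t (inj₁ x) = cong inj₁ (renUnder-⊚ ss ρ ρ′ t x)
  renUnder-⊚ (s ∷ ss) ρ ρ′ t (inj₂ y) = refl

  ren-ren : ∀ {U V W} (ρ : U ⇛ V) (ρ′ : V ⇛ W) t x → ren ρ′ t (ren ρ t x) ≡ ren (ρ′ ⊚ ρ) t x
  renA-ren : ∀ {U V W as} (ρ : U ⇛ V) (ρ′ : V ⇛ W) (xs : Args U as) →
             renA ρ′ (renA ρ xs) ≡ renA (ρ′ ⊚ ρ) xs
  ren-ren ρ ρ′ t (var x)    = refl
  ren-ren ρ ρ′ _ (con i as) = cong (con i) (renA-ren ρ ρ′ as)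
  renA-ren ρ ρ′ []                  = refl
  renA-ren ρ ρ′ (_∷_ {ss} {t} x xs) =
    cong₂ _∷_ (trans (ren-ren (renUnder ss ρ) (renUnder ss ρ′) t x)
                     (ren-cong (renUnder-⊚ ss ρ ρ′) t x))
              (renA-ren ρ ρ′ xs)

  liftSubs-ren : ∀ {U V W} ss (ρ : U ⇛ V) (f : V ⇛ Tm W) →
                 (liftSubs ss f ⊚ renUnder ss ρ) ≗ liftSubs ss (f ⊚ ρ)
  liftSubs-ren []       ρ f t x        = refl
  liftSubs-ren (s ∷ ss) ρ f t (inj₁ x) = cong (ren (wk s) t) (liftSubs-ren ss ρ f t x)
  liftSubs-ren (s ∷ ss) ρ f t (inj₂ y) = refl

  sub-ren : ∀ {U V W} (ρ : U ⇛ V) (f : V ⇛ Tm W) t x → sub f t (ren ρ t x) ≡ sub (f ⊚ ρ) t x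
  subA-ren : ∀ {U V W as} (ρ : U ⇛ V) (f : V ⇛ Tm W) (xs : Args U as) →
             subA f (renA ρ xs) ≡ subA (f ⊚ ρ) xs
  sub-ren ρ f t (var x)    = refl
  sub-ren ρ f _ (con i as) = cong (con i) (subA-ren ρ f as)
  subA-ren ρ f []                  = refl
  subA-ren ρ f (_∷_ {ss} {t} x xs) =
    cong₂ _∷_ (trans (sub-ren (renUnder ss ρ) (liftSubs ss f) t x)
                     (sub-cong (liftSubs-ren ss ρ f) t x))
              (subA-ren ρ f xs)

  ren-liftSubs : ∀ {U V W} ss (f : U ⇛ Tm V) (ρ : V ⇛ W) →
                 (ren (renUnder ss ρ) ⊚ liftSubs ss f) ≗ liftSubs ss (ren ρ ⊚ f)
  ren-liftSubs []       f ρ t x        = refl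
  ren-liftSubs {V = V} (s ∷ ss) f ρ t (inj₁ x) = begin
    ren (renUnder (s ∷ ss) ρ) t (ren (wk s) t y) ≡⟨ ren-ren (wk s) (renUnder (s ∷ ss) ρ) t y ⟩
    ren (wk s ⊚ renUnder ss ρ) t y              ≡⟨ sym (ren-ren (renUnder ss ρ) (wk s) t y) ⟩
    ren (wk s) t (ren (renUnder ss ρ) t y)      ≡⟨ cong (ren (wk s) t) (ren-liftSubs ss f ρ t x) ⟩
    ren (wk s) t (liftSubs ss (ren ρ ⊚ f) t x)  ∎
    where open ≡-Reasoning
          y : Tm (V ▷▷ ss) t
          y = liftSubs ss f t x
  ren-liftSubs (s ∷ ss) f ρ t (inj₂ y) = refl

  ren-sub : ∀ {U V W} (f : U ⇛ Tm V) (ρ : V ⇛ W) t x → ren ρ t (sub f t x) ≡ sub (ren ρ ⊚ f) t x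
  renA-sub : ∀ {U V W as} (f : U ⇛ Tm V) (ρ : V ⇛ W) (xs : Args U as) →
             renA ρ (subA f xs) ≡ subA (ren ρ ⊚ f) xs
  ren-sub f ρ t (var x)    = refl
  ren-sub f ρ _ (con i as) = cong (con i) (renA-sub f ρ as)
  renA-sub f ρ []                  = refl
  renA-sub f ρ (_∷_ {ss} {t} x xs) =
    cong₂ _∷_ (trans (ren-sub (liftSubs ss f) (renUnder ss ρ) t x)
                     (sub-cong (ren-liftSubs ss f ρ) t x))
              (renA-sub f ρ xs)

  sub-liftSubs : ∀ {U V W} ss (f : U ⇛ Tm V) (g : V ⇛ Tm W) →
                 (sub (liftSubs ss g) ⊚ liftSubs ss f) ≗ liftSubs ss (sub g ⊚ f)
  sub-liftSubs []       f g t x        = refl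
  sub-liftSubs {V = V} (s ∷ ss) f g t (inj₁ x) = begin
    sub (liftSubs (s ∷ ss) g) t (ren (wk s) t y)   ≡⟨ sub-ren (wk s) (liftSubs (s ∷ ss) g) t y ⟩
    sub (ren (wk s) ⊚ liftSubs ss g) t y          ≡⟨ sym (ren-sub (liftSubs ss g) (wk s) t y) ⟩
    ren (wk s) t (sub (liftSubs ss g) t y)        ≡⟨ cong (ren (wk s) t) (sub-liftSubs ss f g t x) ⟩
    ren (wk s) t (liftSubs ss (sub g ⊚ f) t x)    ∎
    where open ≡-Reasoning
          y : Tm (V ▷▷ ss) t
          y = liftSubs ss f t x
  sub-liftSubs (s ∷ ss) f g t (inj₂ y) = refl

  sub-sub : ∀ {U V W} (f : U ⇛ Tm V) (g : V ⇛ Tm W) t x → sub g t (sub f t x) ≡ sub (sub g ⊚ f) t x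
  subA-sub : ∀ {U V W as} (f : U ⇛ Tm V) (g : V ⇛ Tm W) (xs : Args U as) →
             subA g (subA f xs) ≡ subA (sub g ⊚ f) xs
  sub-sub f g t (var x)    = refl
  sub-sub f g _ (con i as) = cong (con i) (subA-sub f g as)
  subA-sub f g []                  = refl
  subA-sub f g (_∷_ {ss} {t} x xs) =
    cong₂ _∷_ (trans (sub-sub (liftSubs ss f) (liftSubs ss g) t x)
                     (sub-cong (sub-liftSubs ss f g) t x))
              (subA-sub f g xs)

  liftSubs-var : ∀ {V} ss → liftSubs ss (varF {V}) ≗ varF
  liftSubs-var []       t x        = refl
  liftSubs-var (s ∷ ss) t (inj₁ x) = cong (ren (wk s) t) (liftSubs-var ss t x)
  liftSubs-var (s ∷ ss) t (inj₂ y) = refl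

  sub-var : ∀ {V} t (x : Tm V t) → sub varF t x ≡ x
  subA-var : ∀ {V as} (xs : Args V as) → subA varF xs ≡ xs
  sub-var t (var x)    = refl
  sub-var _ (con i as) = cong (con i) (subA-var as)
  subA-var []                  = refl
  subA-var (_∷_ {ss} {t} x xs) =
    cong₂ _∷_ (trans (sub-cong (liftSubs-var ss) t x) (sub-var t x)) (subA-var xs)

  var-renUnder : ∀ {V W} ss (ρ : V ⇛ W) → (varF ⊚ renUnder ss ρ) ≗ liftSubs ss (varF ⊚ ρ)
  var-renUnder []       ρ t x        = refl
  var-renUnder (s ∷ ss) ρ t (inj₁ x) = cong (ren (wk s) t) (var-renUnder ss ρ t x)
  var-renUnder (s ∷ ss) ρ t (inj₂ y) = refl

  ren-as-sub : ∀ {V W} (ρ : V ⇛ W) t x → ren ρ t x ≡ sub (varF ⊚ ρ) t x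
  renA-as-subA : ∀ {V W as} (ρ : V ⇛ W) (xs : Args V as) → renA ρ xs ≡ subA (varF ⊚ ρ) xs
  ren-as-sub ρ t (var x)    = refl
  ren-as-sub ρ _ (con i as) = cong (con i) (renA-as-subA ρ as)
  renA-as-subA ρ []                  = refl
  renA-as-subA ρ (_∷_ {ss} {t} x xs) =
    cong₂ _∷_ (trans (ren-as-sub (renUnder ss ρ) t x) (sub-cong (var-renUnder ss ρ) t x))
              (renA-as-subA ρ xs)

  ΣMonad : Monad T
  ΣMonad = record
    { P      = Tm
    ; η      = varF
    ; σ      = sub
    ; σ-cong = sub-cong
    ; σ-η    = λ f t x → refl
    ; η-σ    = sub-var
    ; σ-σ    = sub-sub }

  liftMany≗liftSubs : ∀ {V W} ss (f : V ⇛ Tm W) → liftMany ΣMonad ss f ≗ liftSubs ss f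
  liftMany≗liftSubs []       f t x        = refl
  liftMany≗liftSubs (s ∷ ss) f t (inj₁ x) =
    trans (cong (sub (varF ⊚ wk s) t) (liftMany≗liftSubs ss f t x))
          (sym (ren-as-sub (wk s) t (liftSubs ss f t x)))
  liftMany≗liftSubs (s ∷ ss) f t (inj₂ y) = refl

  fromTuple : ∀ V as → ArgTuple ΣMonad as V → Args V as
  fromTuple V []              tt       = []
  fromTuple V ((ss , t) ∷ as) (x , xs) = toExt (taut T ΣMonad) ss V t x ∷ fromTuple V as xs

  toTuple : ∀ V {as} → Args V as → ArgTuple ΣMonad as V
  toTuple V []                  = tt
  toTuple V (_∷_ {ss} {t} x xs) = fromExt (taut T ΣMonad) ss V t x , toTuple V xs

  fromTuple-toTuple : ∀ V {as} (xs : Args V as) → fromTuple V as (toTuple V xs) ≡ xs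
  fromTuple-toTuple V []                  = refl
  fromTuple-toTuple V (_∷_ {ss} {t} x xs) =
    cong₂ _∷_ (toExt-fromExt (taut T ΣMonad) ss V t x) (fromTuple-toTuple V xs)

  fromTuple-subst : ∀ {V W} as (f : V ⇛ Tm W) (xs : ArgTuple ΣMonad as V) →
                    fromTuple W as (substArgs ΣMonad as f xs) ≡ subA f (fromTuple V as xs)
  fromTuple-subst []              f tt       = refl
  fromTuple-subst ((ss , t) ∷ as) f (x , xs) =
    cong₂ _∷_ (trans (toExt-ς (taut T ΣMonad) ss f t x)
                     (sub-cong (liftMany≗liftSubs ss f) t (toExt (taut T ΣMonad) ss _ t x)))
              (fromTuple-subst as f xs)

  conRep : (i : Idx) → Representation T (arity i) ΣMonad
  conRep i = record
    { φ   = λ V xs → con i (fromTuple V (Arity.args (arity i)) xs)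
    ; φ-ς = λ f xs → cong (con i) (fromTuple-subst (Arity.args (arity i)) f xs) }

  ΣRep : RepObj T S
  ΣRep = record { monad = ΣMonad ; rep = conRep }

module Initiality (T : Set) (S : Signature T) (R : RepObj T S) where
  open DerivedModules T
  open Syntax T S
  open Signature S

  Mo : Monad T
  Mo = RepObj.monad R

  PR : Ctx → Ctx
  PR = Monad.P Mo

  ηR : ∀ {V} → V ⇛ PR V
  ηR = Monad.η Mo

  σR : ∀ {V W} → V ⇛ PR W → PR V ⇛ PR W
  σR = Monad.σ Mo

  φR : (i : Idx) → ∀ V → ArgTuple Mo (Arity.args (arity i)) V → PR V (Arity.res (arity i))
  φR i = ModMor₀.φ (RepObj.rep R i)

  fold : ∀ V → Tm V ⇛ PR V
  foldA : ∀ V {as} → Args V as → ArgTuple Mo as V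
  fold V t (var x)    = ηR t x
  fold V _ (con i as) = φR i V (foldA V as)
  foldA V []                  = tt
  foldA V (_∷_ {ss} {t} x xs) = fromExt (taut T Mo) ss V t (fold (V ▷▷ ss) t x) , foldA V xs

  argument-ς : ∀ {V W} ss t (g : V ⇛ PR W) {x : PR (V ▷▷ ss) t} {y : PR (W ▷▷ ss) t} →
               y ≡ σR (liftMany Mo ss g) t x →
               fromExt (taut T Mo) ss W t y
               ≡ Module.ς (derivedL T (taut T Mo) ss) g t (fromExt (taut T Mo) ss V t x)
  argument-ς ss t g {x} e =
    trans (cong (fromExt (taut T Mo) ss _ t) e) (sym (fromExt-ς (taut T Mo) ss g t x))

  η-renUnder : ∀ {V W} ss (ρ : V ⇛ W) → (ηR ⊚ renUnder ss ρ) ≗ liftMany Mo ss (ηR ⊚ ρ)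
  η-renUnder []       ρ t x        = refl
  η-renUnder (s ∷ ss) ρ t (inj₁ x) =
    trans (sym (Monad.σ-η Mo (ηR ⊚ wk s) t (renUnder ss ρ t x)))
          (cong (σR (ηR ⊚ wk s) t) (η-renUnder ss ρ t x))
  η-renUnder (s ∷ ss) ρ t (inj₂ y) = refl

  fold-ren : ∀ {V W} (ρ : V ⇛ W) t x → fold W t (ren ρ t x) ≡ σR (ηR ⊚ ρ) t (fold V t x)
  foldA-ren : ∀ {V W as} (ρ : V ⇛ W) (xs : Args V as) →
              foldA W (renA ρ xs) ≡ substArgs Mo as (ηR ⊚ ρ) (foldA V xs)
  fold-ren ρ t (var x)            = sym (Monad.σ-η Mo (ηR ⊚ ρ) t x)
  fold-ren {V} {W} ρ _ (con i as) =
    trans (cong (φR i W) (foldA-ren ρ as)) (ModMor₀.φ-ς (RepObj.rep R i) (ηR ⊚ ρ) (foldA V as))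
  foldA-ren ρ []                        = refl
  foldA-ren {V} ρ (_∷_ {ss} {t} x xs) =
    cong₂ _,_
      (argument-ς ss t (ηR ⊚ ρ)
        (trans (fold-ren (renUnder ss ρ) t x)
               (Monad.σ-cong Mo (η-renUnder ss ρ) t (fold (V ▷▷ ss) t x))))
      (foldA-ren ρ xs)

  fold-liftSubs : ∀ {V W} ss (f : V ⇛ Tm W) →
                  (fold (W ▷▷ ss) ⊚ liftSubs ss f) ≗ liftMany Mo ss (fold W ⊚ f)
  fold-liftSubs []       f t x        = refl
  fold-liftSubs (s ∷ ss) f t (inj₁ x) =
    trans (fold-ren (wk s) t (liftSubs ss f t x))
          (cong (σR (ηR ⊚ wk s) t) (fold-liftSubs ss f t x))
  fold-liftSubs (s ∷ ss) f t (inj₂ y) = refl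

  fold-sub : ∀ {V W} (f : V ⇛ Tm W) t x → fold W t (sub f t x) ≡ σR (fold W ⊚ f) t (fold V t x)
  foldA-sub : ∀ {V W as} (f : V ⇛ Tm W) (xs : Args V as) →
              foldA W (subA f xs) ≡ substArgs Mo as (fold W ⊚ f) (foldA V xs)
  fold-sub f t (var x)            = sym (Monad.σ-η Mo _ t x)
  fold-sub {V} {W} f _ (con i as) =
    trans (cong (φR i W) (foldA-sub f as)) (ModMor₀.φ-ς (RepObj.rep R i) (fold W ⊚ f) (foldA V as))
  foldA-sub f []                        = refl
  foldA-sub {V} {W} f (_∷_ {ss} {t} x xs) =
    cong₂ _,_
      (argument-ς ss t (fold W ⊚ f)
        (trans (fold-sub (liftSubs ss f) t x)
               (Monad.σ-cong Mo (fold-liftSubs ss f) t (fold (V ▷▷ ss) t x))))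
      (foldA-sub f xs)

  foldMor : MonadMor T ΣMonad Mo
  foldMor = record { τ = fold ; τ-η = λ V t x → refl ; τ-σ = fold-sub }

  foldA-argsComp : ∀ V as (xs : ArgTuple ΣMonad as V) →
                   foldA V (fromTuple V as xs) ≡ argsComp T foldMor as V xs
  foldA-argsComp V []              tt       = refl
  foldA-argsComp V ((ss , t) ∷ as) (x , xs) =
    cong₂ _,_ (sym (derivedComp-ext (taut T ΣMonad) (taut T Mo) fold ss V t x))
              (foldA-argsComp V as xs)

  foldRep : RepMor T ΣRep R
  foldRep = record
    { mor      = foldMor
    ; commutes = λ i V xs → cong (φR i V) (foldA-argsComp V _ xs) }

  module _ (g : RepMor T ΣRep R) where
    private
      τg : ∀ V → Tm V ⇛ PR V
      τg = MonadMor.τ (RepMor.mor g)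

    fold-unique : ∀ V t x → τg V t x ≡ fold V t x
    argsComp-unique : ∀ V {as} (xs : Args V as) →
                      argsComp T (RepMor.mor g) as V (toTuple V xs) ≡ foldA V xs
    fold-unique V t (var x)    = MonadMor.τ-η (RepMor.mor g) V t x
    fold-unique V _ (con i as) = begin
      τg V _ (con i as)
        ≡⟨ cong (λ a → τg V _ (con i a)) (sym (fromTuple-toTuple V as)) ⟩
      τg V _ (con i (fromTuple V args (toTuple V as)))
        ≡⟨ RepMor.commutes g i V (toTuple V as) ⟩
      φR i V (argsComp T (RepMor.mor g) args V (toTuple V as))
        ≡⟨ cong (φR i V) (argsComp-unique V as) ⟩
      φR i V (foldA V as)
        ∎
      where open ≡-Reasoning
            args : List (List T × T)
            args = Arity.args (arity i)
    argsComp-unique V []                  = refl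
    argsComp-unique V (_∷_ {ss} {t} x xs) =
      cong₂ _,_
        (trans (derivedComp-ext (taut T ΣMonad) (taut T Mo) τg ss V t (fromExt (taut T ΣMonad) ss V t x))
               (cong (fromExt (taut T Mo) ss V t)
                     (trans (cong (τg (V ▷▷ ss) t) (toExt-fromExt (taut T ΣMonad) ss V t x))
                            (fold-unique (V ▷▷ ss) t x))))
        (argsComp-unique V xs)

mainTheorem1 : (T : Set) (S : Signature T) → HasInitial T S
mainTheorem1 T S = ΣRep , foldRep , unique
  where
    open Syntax T S using (ΣRep)
    open Initiality T S using (foldRep; fold-unique)

    unique : (R : RepObj T S) (f g : RepMor T ΣRep R) → _≈R_ T f g
    unique R f g V t x = trans (fold-unique R f V t x) (sym (fold-unique R g V t x))
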